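{- Let $G$ be a connected graph and $\ell\geqslant0$. Then $\mathbb{L}_\ell(G)$ is connected if and only if any two $\ell$-links of $G$ with the same middle unit can be shunted to each other.
   Context: All graphs are finite, undirected and loopless; parallel edges are allowed. For $\ell\geqslant0$, an $\ell$-arc of $G$ is a sequence $(v_0,e_1,v_1,\ldots,e_\ell,v_\ell)$ with each $e_i$ an edge with ends $v_{i-1},v_i$ and $e_i\neq e_{i+1}$; an $\ell$-link is an $\ell$-arc identified with its reverse. The $\ell$-link graph $\mathbb{L}_\ell(G)$ has vertex set the $\ell$-links of $G$, and $\ell$-links $L,R$ are joined by as many edges as there are $(\ell+1)$-links $[v_0,e_1,\ldots,e_{\ell+1},v_{\ell+1}]$ with $\{[v_0,\ldots,v_\ell],[v_1,\ldots,v_{\ell+1}]\}=\{L,R\}$. For an $(\ell+s)$-arc $(u_0,f_1,\ldots,f_{\ell+s},u_{\ell+s})$, the $\ell$-link $[u_0,\ldots,u_\ell]$ can be shunted to $[u_s,\ldots,u_{\ell+s}]$ through it; $L$ can be shunted to $R$ if there is a finite chain of such shuntings from $L$ to $R$. The middle unit of $[v_0,e_1,\ldots,e_\ell,v_\ell]$ is $v_{\ell/2}$ if $\ell$ is even and $e_{(\ell+1)/2}$ if $\ell$ is odd. -}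

module Defs where

open import Data.Nat using (ℕ; zero; suc; _+_; _∸_; _≤_; _<_; _/_; _%_; _≡ᵇ_)
open import Data.Fin using (Fin)
open import Data.Bool using (if_then_else_)
open import Data.Product using (Σ; ∃; _×_; _,_; proj₁; proj₂)
open import Data.Sum using (_⊎_)
open import Relation.Binary.PropositionalEquality using (_≡_; _≢_)
open import Relation.Binary.Construct.Closure.ReflexiveTransitive using (Star)

-- A finite loopless multigraph: vertices Fin nV, edges Fin nE,
-- each edge has an (unordered) pair of distinct ends.
record Graph : Set where
  field
    nV    : ℕ
    nE    : ℕ
    ends  : Fin nE → Fin nV × Fin nV
    loopless : ∀ e → proj₁ (ends e) ≢ proj₂ (ends e)

open Graph public

module _ (G : Graph) where

  V : Set
  V = Fin (nV G)

  E : Set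
  E = Fin (nE G)

  Joins : E → V → V → Set
  Joins e u v = (ends G e ≡ (u , v)) ⊎ (ends G e ≡ (v , u))

  Adj : V → V → Set
  Adj u v = ∃ λ e → Joins e u v

  Connected : Set
  Connected = ∀ (u v : V) → Star Adj u v

  -- An ℓ-arc (v_0,e_1,v_1,...,e_ℓ,v_ℓ), stored as sequences indexed from 0:
  -- vtx i = v_i (i ≤ ℓ), edg i = e_{i+1} (i < ℓ); values outside are irrelevant.
  record Arc (ℓ : ℕ) : Set where
    field
      vtx : ℕ → V
      edg : ℕ → E
      inc : ∀ i → i < ℓ → Joins (edg i) (vtx i) (vtx (suc i))
      nb  : ∀ i → suc i < ℓ → edg i ≢ edg (suc i)

  open Arc public

  -- the ℓ-link of arc A equals the ℓ-link given by the raw sequence (w, f)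
  -- (i.e. the two sequences agree on 0..ℓ, directly or after reversal)
  SameLinkSeq : (ℓ : ℕ) → Arc ℓ → (ℕ → V) → (ℕ → E) → Set
  SameLinkSeq ℓ A w f =
      ((∀ i → i ≤ ℓ → vtx A i ≡ w i) × (∀ i → i < ℓ → edg A i ≡ f i))
    ⊎ ((∀ i → i ≤ ℓ → vtx A i ≡ w (ℓ ∸ i)) × (∀ i → i < ℓ → edg A i ≡ f (ℓ ∸ suc i)))

  SameLink : (ℓ : ℕ) → Arc ℓ → Arc ℓ → Set
  SameLink ℓ A B = SameLinkSeq ℓ A (vtx B) (edg B)

  -- L and R are adjacent in 𝕃_ℓ(G): some (ℓ+1)-arc (v_0,...,v_{ℓ+1}) has
  -- {[v_0..v_ℓ],[v_1..v_{ℓ+1}]} = {L,R}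
  LinkAdj : (ℓ : ℕ) → Arc ℓ → Arc ℓ → Set
  LinkAdj ℓ L R = Σ (Arc (suc ℓ)) λ A →
      (SameLinkSeq ℓ L (vtx A) (edg A)
         × SameLinkSeq ℓ R (λ i → vtx A (suc i)) (λ i → edg A (suc i)))
    ⊎ (SameLinkSeq ℓ R (vtx A) (edg A)
         × SameLinkSeq ℓ L (λ i → vtx A (suc i)) (λ i → edg A (suc i)))

  -- 𝕃_ℓ(G) is connected (vertices are ℓ-links, i.e. arcs up to SameLink)
  LinkGraphConnected : ℕ → Set
  LinkGraphConnected ℓ =
    ∀ (L R : Arc ℓ) → Star (λ X Y → SameLink ℓ X Y ⊎ LinkAdj ℓ X Y) L R

  -- one shunting step: L = [u_0..u_ℓ] and R = [u_s..u_{ℓ+s}] for some (ℓ+s)-arc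
  ShuntStep : (ℓ : ℕ) → Arc ℓ → Arc ℓ → Set
  ShuntStep ℓ L R = Σ ℕ λ s → Σ (Arc (ℓ + s)) λ A →
      SameLinkSeq ℓ L (vtx A) (edg A)
    × SameLinkSeq ℓ R (λ i → vtx A (s + i)) (λ i → edg A (s + i))

  Shuntable : (ℓ : ℕ) → Arc ℓ → Arc ℓ → Set
  Shuntable ℓ = Star (ShuntStep ℓ)

  -- middle unit: vertex v_{ℓ/2} (ℓ even) or edge e_{(ℓ+1)/2} (ℓ odd),
  -- the latter being edg (ℓ / 2) in 0-based indexing
  middle : (ℓ : ℕ) → Arc ℓ → V ⊎ E
  middle ℓ A = if ℓ % 2 ≡ᵇ 0 then Data.Sum.inj₁ (vtx A (ℓ / 2))
                              else Data.Sum.inj₂ (edg A (ℓ / 2))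

-- First, for any graph, 𝕃_ℓ(G) is connected iff any two ℓ-links can be shunted to each
-- other: an edge of 𝕃_ℓ(G) is a shunting through an (ℓ+1)-arc, and a shunting through
-- an (ℓ+s)-arc is a walk of length s in 𝕃_ℓ(G).  This gives "⇒" at once.
--
-- For "⇐" let L, R be ℓ-links.  If some arc W begins with an ℓ-link having L's middle
-- unit and ends with one having R's, then L shunts to R: within the middle unit (by the
-- hypothesis), along W, and within the middle unit again.  Such a W is built as
--   (half of L, reversed) · P · (half of R),
-- where P is a non-backtracking walk between the middle units (G is connected, and any
-- walk reduces to a non-backtracking one).  The halves must not turn back onto P, which
-- is arranged by reversing L or R where necessary.  For even ℓ = 2k, P joins the middle
-- vertices; for odd ℓ = 2k+1, P starts with L's middle edge and ends with R's.

module Submission where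

open import Defs
open import Data.Nat
open import Data.Nat.Properties
open import Data.Nat.DivMod using (m*n%n≡0; m*n/n≡m; [m+kn]%n≡m%n; +-distrib-/-∣ʳ)
open import Data.Nat.Divisibility using (divides-refl)
open import Data.Fin using () renaming (_≟_ to _≟ᶠ_)
open import Data.Product using (Σ; _×_; _,_; proj₁; proj₂)
open import Data.Sum using (_⊎_; inj₁; inj₂)
open import Function using (_∘_)
open import Relation.Nullary using (yes; no)
open import Relation.Binary.PropositionalEquality
open import Relation.Binary.Construct.Closure.ReflexiveTransitive using (Star; ε; _◅_; _◅◅_; map; _⋆)
open import Function.Bundles using (_⇔_; mk⇔; Equivalence)

sucReversed : ∀ {m i} → i < m → suc (m ∸ suc i) ≡ m ∸ i
sucReversed {suc m} (s≤s i≤m) = sym (+-∸-assoc 1 i≤m)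

reversed< : ∀ {m i} → i < m → m ∸ suc i < m
reversed< {suc m} {i} (s≤s _) = s≤s (m∸n≤m m i)

reverseEdgInvolutive : ∀ {m i} → i < m → m ∸ suc (m ∸ suc i) ≡ i
reverseEdgInvolutive {m} i<m = trans (cong (m ∸_) (sucReversed i<m)) (m∸[m∸n]≡n (<⇒≤ i<m))

data Split (m : ℕ) : ℕ → Set where
  before : ∀ {i} → i < m → Split m i
  from   : ∀ j → Split m (m + j)

split : ∀ m i → Split m i
split zero i = from i
split (suc m) zero = before (s≤s z≤n)
split (suc m) (suc i) with split m i
... | before i<m = before (s≤s i<m)
... | from j = from j

module _ {a} {A : Set a} where

  _◂_ : A → (ℕ → A) → ℕ → A
  (x ◂ f) zero = x
  (x ◂ f) (suc i) = f i

  concatAt : ℕ → (ℕ → A) → (ℕ → A) → ℕ → A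
  concatAt zero f g = g
  concatAt (suc m) f g = f 0 ◂ concatAt m (f ∘ suc) g

  concat-left : ∀ m f g {i} → i < m → concatAt m f g i ≡ f i
  concat-left (suc m) f g {zero} _ = refl
  concat-left (suc m) f g {suc i} (s≤s i<m) = concat-left m (f ∘ suc) g i<m

  concat-right : ∀ m f g j → concatAt m f g (m + j) ≡ g j
  concat-right zero f g j = refl
  concat-right (suc m) f g j = concat-right m (f ∘ suc) g j

  concat-junction : ∀ m f g → concatAt m f g m ≡ g 0
  concat-junction m f g = trans (cong (concatAt m f g) (sym (+-identityʳ m))) (concat-right m f g 0)

  concat-upTo : ∀ m f g → f m ≡ g 0 → ∀ {i} → i ≤ m → concatAt m f g i ≡ f i
  concat-upTo m f g fm≡g0 {i} i≤m with m≤n⇒m<n∨m≡n i≤m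
  ... | inj₁ i<m = concat-left m f g i<m
  ... | inj₂ refl = trans (concat-junction i f g) (sym fm≡g0)

data Halving : ℕ → Set where
  even : ∀ k → Halving (k + k)
  odd  : ∀ k → Halving (suc (k + k))

halving : ∀ n → Halving n
halving zero = even 0
halving (suc n) with halving n
... | even k = odd k
... | odd k = subst Halving (cong suc (+-suc k k)) (even (suc k))

double : ∀ k → k + k ≡ k * 2
double k = trans (cong (k +_) (sym (+-identityʳ k))) (*-comm 2 k)

even%2 : ∀ k → (k + k) % 2 ≡ 0
even%2 k = trans (cong (_% 2) (double k)) (m*n%n≡0 k 2)

even/2 : ∀ k → (k + k) / 2 ≡ k
even/2 k = trans (cong (_/ 2) (double k)) (m*n/n≡m k 2)

odd%2 : ∀ k → suc (k + k) % 2 ≡ 1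
odd%2 k = trans (cong (λ n → suc n % 2) (double k)) ([m+kn]%n≡m%n 1 k 2)

odd/2 : ∀ k → suc (k + k) / 2 ≡ k
odd/2 k = trans (cong (λ n → suc n / 2) (double k))
                (trans (+-distrib-/-∣ʳ 1 {d = 2} (divides-refl k)) (m*n/n≡m k 2))

middleEdge< : ∀ k → k < suc (k + k)
middleEdge< k = s≤s (m≤m+n k k)

module _ {G : Graph} where

  joins-sym : ∀ {e u v} → Joins G e u v → Joins G e v u
  joins-sym (inj₁ p) = inj₂ p
  joins-sym (inj₂ p) = inj₁ p

  joins-resp : ∀ {e e' u u' v v'} → e ≡ e' → u ≡ u' → v ≡ v' → Joins G e' u' v' → Joins G e u v
  joins-resp refl refl refl j = j

  otherEnd : ∀ {e u v w} → Joins G e u v → Joins G e u w → v ≡ w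
  otherEnd (inj₁ p) (inj₁ q) = cong proj₂ (trans (sym p) q)
  otherEnd (inj₁ p) (inj₂ q) = trans (cong proj₂ (trans (sym p) q)) (cong proj₁ (trans (sym p) q))
  otherEnd (inj₂ p) (inj₁ q) = trans (cong proj₁ (trans (sym p) q)) (cong proj₂ (trans (sym p) q))
  otherEnd (inj₂ p) (inj₂ q) = cong proj₁ (trans (sym p) q)

  -- Operations on arcs.  All of them keep the vertex and edge sequences definitionally
  -- recognisable, so that the positions of the result can be read off.

  castArc : ∀ {m n} → m ≡ n → Arc G m → Arc G n
  castArc m≡n A = record
    { vtx = vtx A ; edg = edg A
    ; inc = λ i i<n → inc A i (subst (i <_) (sym m≡n) i<n)
    ; nb  = λ i i<n → nb A i (subst (suc i <_) (sym m≡n) i<n) }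

  prefix : ∀ {m n} → n ≤ m → Arc G m → Arc G n
  prefix n≤m A = record
    { vtx = vtx A ; edg = edg A
    ; inc = λ i i<n → inc A i (≤-trans i<n n≤m)
    ; nb  = λ i i<n → nb A i (≤-trans i<n n≤m) }

  tail : ∀ {m} → Arc G (suc m) → Arc G m
  tail A = record
    { vtx = vtx A ∘ suc ; edg = edg A ∘ suc
    ; inc = λ i i<m → inc A (suc i) (s≤s i<m)
    ; nb  = λ i i<m → nb A (suc i) (s≤s i<m) }

  drop : ∀ {m} s → Arc G (s + m) → Arc G m
  drop zero A = A
  drop (suc s) A = drop s (tail A)

  drop-vtx : ∀ {m} s (A : Arc G (s + m)) i → vtx (drop s A) i ≡ vtx A (s + i)
  drop-vtx zero A i = refl
  drop-vtx (suc s) A i = drop-vtx s (tail A) i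

  drop-edg : ∀ {m} s (A : Arc G (s + m)) i → edg (drop s A) i ≡ edg A (s + i)
  drop-edg zero A i = refl
  drop-edg (suc s) A i = drop-edg s (tail A) i

  drop-start : ∀ {m} s (A : Arc G (s + m)) → vtx (drop s A) 0 ≡ vtx A s
  drop-start s A = trans (drop-vtx s A 0) (cong (vtx A) (+-identityʳ s))

  drop-firstEdge : ∀ {m} s (A : Arc G (s + m)) → edg (drop s A) 0 ≡ edg A s
  drop-firstEdge s A = trans (drop-edg s A 0) (cong (edg A) (+-identityʳ s))

  lastWindow : ∀ {ℓ} s → Arc G (ℓ + s) → Arc G ℓ
  lastWindow {ℓ} s W = drop s (castArc (+-comm ℓ s) W)

  lastWindow-vtx : ∀ {ℓ} s (W : Arc G (ℓ + s)) i → vtx (lastWindow s W) i ≡ vtx W (s + i)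
  lastWindow-vtx {ℓ} s W = drop-vtx s (castArc (+-comm ℓ s) W)

  lastWindow-edg : ∀ {ℓ} s (W : Arc G (ℓ + s)) i → edg (lastWindow s W) i ≡ edg W (s + i)
  lastWindow-edg {ℓ} s W = drop-edg s (castArc (+-comm ℓ s) W)

  reverse : ∀ {m} → Arc G m → Arc G m
  reverse {m} A = record
    { vtx = λ i → vtx A (m ∸ i) ; edg = λ i → edg A (m ∸ suc i)
    ; inc = λ i i<m → joins-sym (joins-resp refl refl (cong (vtx A) (sym (sucReversed i<m)))
                                  (inc A (m ∸ suc i) (reversed< i<m)))
    ; nb  = λ i si<m eq → nb A (m ∸ suc (suc i))
                             (subst (_< m) (sym (sucReversed si<m)) (reversed< (<⇒≤ si<m)))
                             (trans (sym eq) (cong (edg A) (sym (sucReversed si<m)))) }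

  edgeArc : ∀ {e u v} → Joins G e u v → Arc G 1
  edgeArc {e} {u} {v} j = record
    { vtx = u ◂ λ _ → v ; edg = λ _ → e
    ; inc = λ { zero _ → j ; (suc i) (s≤s ()) } ; nb = λ { i (s≤s ()) } }

  glue : ∀ {m n} (X : Arc G m) (Y : Arc G n) → vtx X m ≡ vtx Y 0 →
         (∀ i → suc i ≡ m → 0 < n → edg X i ≢ edg Y 0) → Arc G (m + n)
  glue {m} {n} X Y meet noTurn = record { vtx = vs ; edg = es ; inc = incident ; nb = noBacktrack }
    where
    vs : ℕ → V G
    vs = concatAt m (vtx X) (vtx Y)
    es : ℕ → E G
    es = concatAt m (edg X) (edg Y)

    vs-suc : ∀ j → vs (suc (m + j)) ≡ vtx Y (suc j)
    vs-suc j = trans (cong vs (sym (+-suc m j))) (concat-right m (vtx X) (vtx Y) (suc j))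

    es-suc : ∀ j → es (suc (m + j)) ≡ edg Y (suc j)
    es-suc j = trans (cong es (sym (+-suc m j))) (concat-right m (edg X) (edg Y) (suc j))

    incident : ∀ i → i < m + n → Joins G (es i) (vs i) (vs (suc i))
    incident i i<m+n with split m i
    ... | before i<m = joins-resp (concat-left m _ _ i<m) (concat-upTo m _ _ meet (<⇒≤ i<m))
                                  (concat-upTo m _ _ meet i<m) (inc X i i<m)
    ... | from j = joins-resp (concat-right m _ _ j) (concat-right m _ _ j) (vs-suc j)
                              (inc Y j (+-cancelˡ-< m j n i<m+n))

    noBacktrack : ∀ i → suc i < m + n → es i ≢ es (suc i)
    noBacktrack i si<m+n with split m i
    ... | from j = λ eq → nb Y j (+-cancelˡ-< m (suc j) n (subst (_< m + n) (sym (+-suc m j)) si<m+n))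
                            (trans (sym (concat-right m _ _ j)) (trans eq (es-suc j)))
    ... | before i<m with m≤n⇒m<n∨m≡n i<m
    ...   | inj₁ si<m = λ eq → nb X i si<m
                                  (trans (sym (concat-left m _ _ i<m)) (trans eq (concat-left m _ _ si<m)))
    ...   | inj₂ si≡m = λ eq → noTurn i si≡m
                                  (+-cancelˡ-< m 0 n (subst (_< m + n) (trans si≡m (sym (+-identityʳ m))) si<m+n))
                                  (trans (sym (concat-left m _ _ i<m))
                                         (trans eq (trans (cong es si≡m) (concat-junction m _ _))))

  record Path (u v : V G) : Set where
    constructor path
    field
      len    : ℕ
      arc    : Arc G len
      start  : vtx arc 0 ≡ u
      finish : vtx arc len ≡ v

  open Path public

  -- the trivial path at u; a 0-arc still needs some (irrelevant) edge sequence
  stay : E G → (u : V G) → Path u u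
  stay d u = path 0 (record { vtx = λ _ → u ; edg = λ _ → d ; inc = λ _ () ; nb = λ _ () }) refl refl

  NotStartingWith : ∀ {u v} → E G → Path u v → Set
  NotStartingWith g P = 0 < len P → edg (arc P) 0 ≢ g

  NotEndingWith : ∀ {u v} → E G → Path u v → Set
  NotEndingWith g P = ∀ i → suc i ≡ len P → edg (arc P) i ≢ g

  restart : ∀ {u u' v} → u ≡ u' → Path u v → Path u' v
  restart u≡u' (path q Q h0 hq) = path q Q (trans h0 u≡u') hq

  prependEdge : ∀ {e u w v} → Joins G e u w → (P : Path w v) → NotStartingWith e P → Path u v
  prependEdge j (path q Q h0 hq) notStart =
    path (1 + q) (glue (edgeArc j) Q (sym h0) λ { zero refl 0<q eq → notStart 0<q (sym eq) })
         refl (trans (concat-right 1 (vtx (edgeArc j)) (vtx Q) q) hq)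

  cancelEdge : ∀ {e u w v q} → Joins G e u w → (Q : Arc G (suc q)) →
               vtx Q 0 ≡ w → vtx Q (suc q) ≡ v → edg Q 0 ≡ e → Path u v
  cancelEdge j Q h0 hq eq =
    path _ (tail Q) (otherEnd (joins-resp (sym eq) (sym h0) refl (inc Q 0 (s≤s z≤n))) (joins-sym j)) hq

  -- in a graph, a walk can be reduced to a non-backtracking one
  -- (the edge d is only needed to represent the trivial path)
  toPath : E G → ∀ {u v} → Star (Adj G) u v → Path u v
  toPath d {u} ε = stay d u
  toPath d ((e , j) ◅ walk) with toPath d walk
  ... | path zero Q h0 hq = prependEdge j (path zero Q h0 hq) λ ()
  ... | path (suc q) Q h0 hq with edg Q 0 ≟ᶠ e
  ...   | no  ≢e = prependEdge j (path (suc q) Q h0 hq) λ _ → ≢e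
  ...   | yes ≡e = cancelEdge j Q h0 hq ≡e

  appendEdge : ∀ {e u w v} (P : Path u w) → Joins G e w v → NotEndingWith e P → Path u v
  appendEdge (path q Q h0 hq) j notEnd =
    path (suc q) (castArc (+-comm q 1) (glue Q (edgeArc j) hq λ i si≡q _ → notEnd i si≡q))
         (trans (concat-upTo q (vtx Q) (vtx (edgeArc j)) hq z≤n) h0)
         (trans (cong (concatAt q (vtx Q) (vtx (edgeArc j))) (+-comm 1 q))
                (concat-right q (vtx Q) (vtx (edgeArc j)) 1))

  appendEdge-start : ∀ {e f u w v} (P : Path u w) (j : Joins G f w v) (notEnd : NotEndingWith f P) →
                     NotStartingWith e P → (len P ≡ 0 → f ≢ e) → NotStartingWith e (appendEdge P j notEnd)
  appendEdge-start (path zero Q h0 hq) j notEnd _ f≢e _ = f≢e refl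
  appendEdge-start (path (suc q) Q h0 hq) j notEnd notStart _ _ = notStart (s≤s z≤n)

  bracket : ∀ {e f x u v y} → Joins G e x u → Joins G f v y → (Q : Path u v) →
            NotStartingWith e Q → NotEndingWith f Q → (len Q ≡ 0 → e ≢ f) →
            Σ ℕ λ p → Σ (Arc G (suc p)) λ P →
              vtx P 0 ≡ x × vtx P (suc p) ≡ y × edg P 0 ≡ e × edg P p ≡ f
  bracket {e} {f} jx jy Q notStart notEnd e≢f =
    suc (len Q) , arc P , start P , finish P , refl , concat-junction (len Q) (edg (arc Q)) (λ _ → f)
    where
    P : Path _ _
    P = prependEdge jx (appendEdge Q jy notEnd)
          (appendEdge-start Q jy notEnd notStart λ len≡0 f≡e → e≢f len≡0 (sym f≡e))

  middle-even : ∀ k (A : Arc G (k + k)) → middle G (k + k) A ≡ inj₁ (vtx A k)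
  middle-even k A rewrite even%2 k | even/2 k = refl

  middle-odd : ∀ k (A : Arc G (suc (k + k))) → middle G (suc (k + k)) A ≡ inj₂ (edg A k)
  middle-odd k A rewrite odd%2 k | odd/2 k = refl

  sameMiddle-even : ∀ k (A B : Arc G (k + k)) → vtx A k ≡ vtx B k → middle G (k + k) A ≡ middle G (k + k) B
  sameMiddle-even k A B eq = trans (middle-even k A) (trans (cong inj₁ eq) (sym (middle-even k B)))

  sameMiddle-odd : ∀ k (A B : Arc G (suc (k + k))) → edg A k ≡ edg B k →
                   middle G (suc (k + k)) A ≡ middle G (suc (k + k)) B
  sameMiddle-odd k A B eq = trans (middle-odd k A) (trans (cong inj₂ eq) (sym (middle-odd k B)))

  -- A backwards, then P, then B: an arc of length k + (p+1) + k running through P at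
  -- positions k .. k+p+1, provided the legs A and B start at P's ends and leave them
  -- along edges other than P's end edges.
  sandwich : ∀ {k p} (A B : Arc G k) (P : Arc G (suc p)) →
             vtx A 0 ≡ vtx P 0 → vtx B 0 ≡ vtx P (suc p) →
             (0 < k → edg A 0 ≢ edg P 0) → (0 < k → edg B 0 ≢ edg P p) →
             Σ (Arc G (k + suc p + k)) λ W →
               (∀ i → i ≤ suc p → vtx W (k + i) ≡ vtx P i) ×
               (∀ i → i < suc p → edg W (k + i) ≡ edg P i)
  sandwich {k} {p} A B P vA vB eA eB = W , onVertices , onEdges
    where
    legEnd : vtx (reverse A) k ≡ vtx P 0
    legEnd = trans (cong (vtx A) (n∸n≡0 k)) vA

    legTurn : ∀ i → suc i ≡ k → 0 < suc p → edg (reverse A) i ≢ edg P 0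
    legTurn i si≡k _ eq = eA (subst (0 <_) si≡k (s≤s z≤n))
      (trans (cong (edg A) (sym (n∸n≡0 i))) (trans (cong (λ m → edg A (m ∸ suc i)) si≡k) eq))

    AP : Arc G (k + suc p)
    AP = glue (reverse A) P legEnd legTurn

    apEnd : vtx AP (k + suc p) ≡ vtx B 0
    apEnd = trans (concat-right k (vtx (reverse A)) (vtx P) (suc p)) (sym vB)

    apTurn : ∀ i → suc i ≡ k + suc p → 0 < k → edg AP i ≢ edg B 0
    apTurn i si≡ 0<k eq = eB 0<k (trans (sym eq)
      (trans (cong (edg AP) (suc-injective (trans si≡ (+-suc k p))))
             (concat-right k (edg (reverse A)) (edg P) p)))

    W : Arc G (k + suc p + k)
    W = glue AP B apEnd apTurn

    onVertices : ∀ i → i ≤ suc p → vtx W (k + i) ≡ vtx P i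
    onVertices i i≤ = trans (concat-upTo (k + suc p) (vtx AP) (vtx B) apEnd (+-monoʳ-≤ k i≤))
                            (concat-right k (vtx (reverse A)) (vtx P) i)

    onEdges : ∀ i → i < suc p → edg W (k + i) ≡ edg P i
    onEdges i i< = trans (concat-left (k + suc p) (edg AP) (edg B) (+-monoʳ-< k i<))
                         (concat-right k (edg (reverse A)) (edg P) i)

  leaveMiddle : ∀ k (L : Arc G (k + k)) (g : E G) →
                Σ (Arc G (k + k)) λ L' → vtx L' k ≡ vtx L k × (0 < k → edg L' k ≢ g)
  leaveMiddle zero L g = L , refl , λ ()
  leaveMiddle (suc k) L g with edg L (suc k) ≟ᶠ g
  ... | no  ≢g = L , refl , λ _ → ≢g
  ... | yes ≡g = reverse L , cong (vtx L) (m+n∸n≡m (suc k) (suc k)) ,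
                 λ _ eq → nb L k (s≤s (m≤n+m (suc k) k))
                              (trans (cong (edg L) (sym (m+n∸n≡m k (suc k)))) (trans eq (sym ≡g)))

  reverse-middleEdge : ∀ k (L : Arc G (suc (k + k))) → edg (reverse L) k ≡ edg L k
  reverse-middleEdge k L = cong (edg L) (m+n∸n≡m k k)

  reverse-middleVtx : ∀ k (L : Arc G (suc (k + k))) → vtx L (suc k) ≡ vtx (reverse L) k
  reverse-middleVtx k L = cong (vtx L) (sym (m+n∸n≡m (suc k) k))

  -- a path from the end v_k of the middle edge of an odd link L can be made not to start
  -- along that edge: otherwise drop the edge and reverse L
  departOdd : ∀ k (L : Arc G (suc (k + k))) {v} (Q : Path (vtx L k) v) →
              Σ (Arc G (suc (k + k))) λ L' → edg L' k ≡ edg L k ×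
                Σ (Path (vtx L' k) v) (NotStartingWith (edg L k))
  departOdd k L (path zero Q h0 hq) = L , refl , path zero Q h0 hq , λ ()
  departOdd k L (path (suc q) Q h0 hq) with edg Q 0 ≟ᶠ edg L k
  ... | no  ≢e = L , refl , path (suc q) Q h0 hq , λ _ → ≢e
  ... | yes ≡e = reverse L , reverse-middleEdge k L ,
                 restart (reverse-middleVtx k L)
                         (cancelEdge (joins-sym (inc L k (middleEdge< k))) Q h0 hq ≡e) ,
                 λ 0<q eq → nb Q 0 (s≤s 0<q) (trans ≡e (sym eq))

  arriveOdd : ∀ k (R : Arc G (suc (k + k))) {u} (g : E G) (Q : Path u (vtx R k)) → NotStartingWith g Q →
              Σ (Arc G (suc (k + k))) λ R' → edg R' k ≡ edg R k ×
                Σ (Path u (vtx R' k)) λ Q' → NotStartingWith g Q' × NotEndingWith (edg R k) Q'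
  arriveOdd k R g (path zero Q h0 hq) notStart = R , refl , path zero Q h0 hq , notStart , λ _ ()
  arriveOdd k R g (path (suc q) Q h0 hq) notStart with edg Q q ≟ᶠ edg R k
  ... | no  ≢e = R , refl , path (suc q) Q h0 hq , notStart , λ { i refl → ≢e }
  ... | yes ≡e = reverse R , reverse-middleEdge k R , path q (prefix (n≤1+n q) Q) h0 crossed ,
                 (λ _ → notStart (s≤s z≤n)) , λ { i refl eq → nb Q i ≤-refl (trans eq (sym ≡e)) }
    where
    crossed : vtx Q q ≡ vtx (reverse R) k
    crossed = trans (otherEnd (joins-resp (sym ≡e) (sym hq) refl (joins-sym (inc Q q ≤-refl)))
                              (inc R k (middleEdge< k)))
                    (reverse-middleVtx k R)

module _ {G : Graph} {ℓ : ℕ} where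

  sameSeq-refl : ∀ (X : Arc G ℓ) → SameLinkSeq G ℓ X (vtx X) (edg X)
  sameSeq-refl X = inj₁ ((λ _ _ → refl) , (λ _ _ → refl))

  sameSeq-cong : ∀ {X : Arc G ℓ} {w w' f f'} → SameLinkSeq G ℓ X w f →
                 (∀ i → i ≤ ℓ → w i ≡ w' i) → (∀ i → i < ℓ → f i ≡ f' i) →
                 SameLinkSeq G ℓ X w' f'
  sameSeq-cong (inj₁ (vs , es)) w≡ f≡ =
    inj₁ ((λ i i≤ℓ → trans (vs i i≤ℓ) (w≡ i i≤ℓ)) ,
          (λ i i<ℓ → trans (es i i<ℓ) (f≡ i i<ℓ)))
  sameSeq-cong (inj₂ (vs , es)) w≡ f≡ =
    inj₂ ((λ i i≤ℓ → trans (vs i i≤ℓ) (w≡ (ℓ ∸ i) (m∸n≤m ℓ i))) ,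
          (λ i i<ℓ → trans (es i i<ℓ) (f≡ (ℓ ∸ suc i) (reversed< i<ℓ))))

  sameSeq-rev : ∀ {X : Arc G ℓ} {w f} → SameLinkSeq G ℓ X w f →
                SameLinkSeq G ℓ X (λ i → w (ℓ ∸ i)) (λ i → f (ℓ ∸ suc i))
  sameSeq-rev {w = w} {f} (inj₁ (vs , es)) =
    inj₂ ((λ i i≤ℓ → trans (vs i i≤ℓ) (cong w (sym (m∸[m∸n]≡n i≤ℓ)))) ,
          (λ i i<ℓ → trans (es i i<ℓ) (cong f (sym (reverseEdgInvolutive i<ℓ)))))
  sameSeq-rev (inj₂ vs,es) = inj₁ vs,es

  sameSeq-trans : ∀ {X Y : Arc G ℓ} {w f} → SameLinkSeq G ℓ X w f → SameLinkSeq G ℓ Y w f →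
                  SameLink G ℓ X Y
  sameSeq-trans (inj₁ (vs , es)) (inj₁ (vs' , es')) =
    inj₁ ((λ i i≤ℓ → trans (vs i i≤ℓ) (sym (vs' i i≤ℓ))) ,
          (λ i i<ℓ → trans (es i i<ℓ) (sym (es' i i<ℓ))))
  sameSeq-trans (inj₂ (vs , es)) (inj₂ (vs' , es')) =
    inj₁ ((λ i i≤ℓ → trans (vs i i≤ℓ) (sym (vs' i i≤ℓ))) ,
          (λ i i<ℓ → trans (es i i<ℓ) (sym (es' i i<ℓ))))
  sameSeq-trans {w = w} {f} (inj₁ (vs , es)) (inj₂ (vs' , es')) =
    inj₂ ((λ i i≤ℓ → trans (vs i i≤ℓ) (trans (cong w (sym (m∸[m∸n]≡n i≤ℓ)))
                                                (sym (vs' (ℓ ∸ i) (m∸n≤m ℓ i))))) ,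
          (λ i i<ℓ → trans (es i i<ℓ) (trans (cong f (sym (reverseEdgInvolutive i<ℓ)))
                                                (sym (es' (ℓ ∸ suc i) (reversed< i<ℓ))))))
  sameSeq-trans (inj₂ (vs , es)) (inj₁ (vs' , es')) =
    inj₂ ((λ i i≤ℓ → trans (vs i i≤ℓ) (sym (vs' (ℓ ∸ i) (m∸n≤m ℓ i)))) ,
          (λ i i<ℓ → trans (es i i<ℓ) (sym (es' (ℓ ∸ suc i) (reversed< i<ℓ)))))

  LinkStep : Arc G ℓ → Arc G ℓ → Set
  LinkStep X Y = SameLink G ℓ X Y ⊎ LinkAdj G ℓ X Y

  -- equal links are a shunting through an ℓ-arc, adjacent ones through an (ℓ+1)-arc
  linkStep⇒shunt : ∀ {X Y} → LinkStep X Y → ShuntStep G ℓ X Y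
  linkStep⇒shunt {Y = Y} (inj₁ X≈Y) = 0 , castArc (sym (+-identityʳ ℓ)) Y , X≈Y , sameSeq-refl Y
  linkStep⇒shunt (inj₂ (A , inj₁ (X~ , Y~))) = 1 , castArc (+-comm 1 ℓ) A , X~ , Y~
  linkStep⇒shunt {X} {Y} (inj₂ (A , inj₂ (Y~ , X~))) =
    1 , castArc (+-comm 1 ℓ) (reverse A) ,
    sameSeq-cong {X} (sameSeq-rev {X} {vtx A ∘ suc} {edg A ∘ suc} X~)
                 (λ i i≤ℓ → cong (vtx A) (sym (+-∸-assoc 1 i≤ℓ)))
                 (λ i i<ℓ → cong (edg A) (sucReversed i<ℓ)) ,
    sameSeq-rev {Y} {vtx A} {edg A} Y~

  shunt⇒linkWalk : ∀ {X Y} s (A : Arc G (ℓ + s)) → SameLinkSeq G ℓ X (vtx A) (edg A) →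
                   SameLinkSeq G ℓ Y (λ i → vtx A (s + i)) (λ i → edg A (s + i)) → Star LinkStep X Y
  shunt⇒linkWalk {X} {Y} zero A X~ Y~ = inj₁ (sameSeq-trans {X} {Y} {vtx A} {edg A} X~ Y~) ◅ ε
  shunt⇒linkWalk {Y = Y} (suc s) A X~ Y~ =
    inj₂ (prefix (s≤s (m≤m+n ℓ s)) A' , inj₁ (X~ , sameSeq-refl Z)) ◅
    shunt⇒linkWalk {Z} {Y} s (tail A') (sameSeq-refl Z) Y~
    where
    A' : Arc G (suc (ℓ + s))
    A' = castArc (+-suc ℓ s) A
    Z : Arc G ℓ
    Z = prefix (m≤m+n ℓ s) (tail A')

  linkGraphConnected⇔shuntable : LinkGraphConnected G ℓ ⇔ (∀ (L R : Arc G ℓ) → Shuntable G ℓ L R)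
  linkGraphConnected⇔shuntable = mk⇔
    (λ connected L R → map (λ {X} {Y} → linkStep⇒shunt {X} {Y}) (connected L R))
    (λ shuntable L R → (shuntStep⇒linkWalk ⋆) (shuntable L R))
    where
    shuntStep⇒linkWalk : ∀ {X Y} → ShuntStep G ℓ X Y → Star LinkStep X Y
    shuntStep⇒linkWalk {X} {Y} (s , A , X~ , Y~) = shunt⇒linkWalk {X} {Y} s A X~ Y~

SameMiddleShuntable : Graph → ℕ → Set
SameMiddleShuntable G ℓ = ∀ (L R : Arc G ℓ) → middle G ℓ L ≡ middle G ℓ R → Shuntable G ℓ L R

module _ {G : Graph} {ℓ : ℕ} (sameMiddle⇒shuntable : SameMiddleShuntable G ℓ) where

  -- under the condition, L shunts to R as soon as some arc begins with a link of L's
  -- middle unit and ends with a link of R's: shunt within the middle unit, along the arc,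
  -- and within the middle unit again
  shuntAcross : ∀ {L R : Arc G ℓ} s (W : Arc G (ℓ + s)) →
                middle G ℓ L ≡ middle G ℓ (prefix (m≤m+n ℓ s) W) →
                middle G ℓ (lastWindow s W) ≡ middle G ℓ R → Shuntable G ℓ L R
  shuntAcross {L} {R} s W midL midR =
    sameMiddle⇒shuntable L first midL ◅◅
    ((s , W , sameSeq-refl first ,
      sameSeq-cong {X = last} (sameSeq-refl last)
                   (λ i _ → lastWindow-vtx s W i) (λ i _ → lastWindow-edg s W i))
     ◅ sameMiddle⇒shuntable last R midR)
    where
    first last : Arc G ℓ
    first = prefix (m≤m+n ℓ s) W
    last = lastWindow s W

-- the length k + (p+1) + k of a sandwich arc, as ℓ + s for ℓ = 2k and ℓ = 2k+1
sandwichLength-even : ∀ k p → k + suc p + k ≡ (k + k) + suc p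
sandwichLength-even k p = begin
  k + suc p + k      ≡⟨ +-assoc k (suc p) k ⟩
  k + (suc p + k)    ≡⟨ cong (k +_) (+-comm (suc p) k) ⟩
  k + (k + suc p)    ≡⟨ +-assoc k k (suc p) ⟨
  (k + k) + suc p    ∎
  where open ≡-Reasoning

sandwichLength-odd : ∀ k p → k + suc p + k ≡ suc (k + k) + p
sandwichLength-odd k p = trans (sandwichLength-even k p) (+-suc (k + k) p)

module _ {G : Graph} where
  open ≡-Reasoning

  bridgeEven : ∀ k {p} → SameMiddleShuntable G (k + k) →
               (L R : Arc G (k + k)) (P : Arc G (suc p)) →
               vtx L k ≡ vtx P 0 → vtx R k ≡ vtx P (suc p) →
               (0 < k → edg L k ≢ edg P 0) → (0 < k → edg R k ≢ edg P p) → Shuntable G (k + k) L R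
  bridgeEven k {p} H L R P vL vR eL eR
    with sandwich (drop k L) (drop k R) P (trans (drop-start k L) vL) (trans (drop-start k R) vR)
                  (λ 0<k eq → eL 0<k (trans (sym (drop-firstEdge k L)) eq))
                  (λ 0<k eq → eR 0<k (trans (sym (drop-firstEdge k R)) eq))
  ... | W , onVertices , _ =
    shuntAcross H (suc p) W' (sameMiddle-even k L (prefix (m≤m+n (k + k) (suc p)) W') midL)
                             (sameMiddle-even k (lastWindow (suc p) W') R midR)
    where
    W' : Arc G ((k + k) + suc p)
    W' = castArc (sandwichLength-even k p) W
    midL : vtx L k ≡ vtx W k
    midL = begin
      vtx L k        ≡⟨ vL ⟩
      vtx P 0        ≡⟨ onVertices 0 z≤n ⟨
      vtx W (k + 0)  ≡⟨ cong (vtx W) (+-identityʳ k) ⟩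
      vtx W k        ∎
    midR : vtx (lastWindow (suc p) W') k ≡ vtx R k
    midR = begin
      vtx (lastWindow (suc p) W') k  ≡⟨ lastWindow-vtx (suc p) W' k ⟩
      vtx W (suc p + k)              ≡⟨ cong (vtx W) (+-comm (suc p) k) ⟩
      vtx W (k + suc p)              ≡⟨ onVertices (suc p) ≤-refl ⟩
      vtx P (suc p)                  ≡⟨ vR ⟨
      vtx R k                        ∎

  bridgeOdd : ∀ k {p} → SameMiddleShuntable G (suc (k + k)) →
              (L R : Arc G (suc (k + k))) (P : Arc G (suc p)) →
              vtx L (suc k) ≡ vtx P 0 → vtx R (suc k) ≡ vtx P (suc p) →
              edg L k ≡ edg P 0 → edg R k ≡ edg P p → Shuntable G (suc (k + k)) L R
  bridgeOdd k {p} H L R P vL vR eL eR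
    with sandwich (drop (suc k) L) (drop (suc k) R) P
                  (trans (drop-start (suc k) L) vL) (trans (drop-start (suc k) R) vR)
                  (legTurns L eL) (legTurns R eR)
    where
    legTurns : ∀ (A : Arc G (suc (k + k))) {g} → edg A k ≡ g → 0 < k → edg (drop (suc k) A) 0 ≢ g
    legTurns A mid≡g 0<k eq =
      nb A k (s≤s (+-monoˡ-≤ k 0<k)) (trans mid≡g (trans (sym eq) (drop-firstEdge (suc k) A)))
  ... | W , _ , onEdges =
    shuntAcross H p W' (sameMiddle-odd k L (prefix (m≤m+n (suc (k + k)) p) W') midL)
                       (sameMiddle-odd k (lastWindow p W') R midR)
    where
    W' : Arc G (suc (k + k) + p)
    W' = castArc (sandwichLength-odd k p) W
    midL : edg L k ≡ edg W k
    midL = begin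
      edg L k        ≡⟨ eL ⟩
      edg P 0        ≡⟨ onEdges 0 (s≤s z≤n) ⟨
      edg W (k + 0)  ≡⟨ cong (edg W) (+-identityʳ k) ⟩
      edg W k        ∎
    midR : edg (lastWindow p W') k ≡ edg R k
    midR = begin
      edg (lastWindow p W') k  ≡⟨ lastWindow-edg p W' k ⟩
      edg W (p + k)            ≡⟨ cong (edg W) (+-comm p k) ⟩
      edg W (k + p)            ≡⟨ onEdges p ≤-refl ⟩
      edg P p                  ≡⟨ eR ⟨
      edg R k                  ∎

  -- In a connected graph, the condition makes any two even links shuntable to each other:
  -- join their middle vertices by a non-backtracking walk and orient both links away from it.
  shuntableEven : Connected G → ∀ k → SameMiddleShuntable G (k + k) →
                  ∀ (L R : Arc G (k + k)) → Shuntable G (k + k) L R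
  shuntableEven connected k H L R with toPath (edg L 0) (connected (vtx L k) (vtx R k))
  ... | path zero P s f = H L R (sameMiddle-even k L R (trans (sym s) f))
  ... | path (suc p) P s f with leaveMiddle k L (edg P 0) | leaveMiddle k R (edg P p)
  ...   | L' , L'≡ , L'leaves | R' , R'≡ , R'leaves =
    H L L' (sameMiddle-even k L L' (sym L'≡)) ◅◅
    bridgeEven k H L' R' P (trans L'≡ (sym s)) (trans R'≡ (sym f)) L'leaves R'leaves ◅◅
    H R' R (sameMiddle-even k R' R R'≡)

  -- The same for odd links: unless the middle edges agree, extend a non-backtracking walk
  -- between them by both middle edges, orienting the links accordingly.
  shuntableOdd : Connected G → ∀ k → SameMiddleShuntable G (suc (k + k)) →
                 ∀ (L R : Arc G (suc (k + k))) → Shuntable G (suc (k + k)) L R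
  shuntableOdd connected k H L R with edg L k ≟ᶠ edg R k
  ... | yes same = H L R (sameMiddle-odd k L R same)
  ... | no differ with departOdd k L (toPath (edg L 0) (connected (vtx L k) (vtx R k)))
  ...   | L' , L'≡ , Q , notStart with arriveOdd k R (edg L k) Q notStart
  ...     | R' , R'≡ , Q' , notStart' , notEnd
            with bracket (joins-sym {G} (inc L' k (middleEdge< k))) (inc R' k (middleEdge< k)) Q'
                   (subst (λ g → NotStartingWith g Q') (sym L'≡) notStart')
                   (subst (λ g → NotEndingWith g Q') (sym R'≡) notEnd)
                   (λ _ eq → differ (trans (sym L'≡) (trans eq R'≡)))
  ...       | p , P , s , f , first , last =
    H L L' (sameMiddle-odd k L L' (sym L'≡)) ◅◅
    bridgeOdd k H L' R' P (sym s) (sym f) (sym first) (sym last) ◅◅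
    H R' R (sameMiddle-odd k R' R R'≡)

  shuntableAll : Connected G → ∀ ℓ → SameMiddleShuntable G ℓ →
                 ∀ (L R : Arc G ℓ) → Shuntable G ℓ L R
  shuntableAll connected ℓ H with halving ℓ
  ... | even k = shuntableEven connected k H
  ... | odd k = shuntableOdd connected k H

mainTheorem15 : (G : Graph) → Connected G → (ℓ : ℕ) →
    LinkGraphConnected G ℓ ⇔
      (∀ (L R : Arc G ℓ) → middle G ℓ L ≡ middle G ℓ R → Shuntable G ℓ L R)
mainTheorem15 G connected ℓ = mk⇔
  (λ linkConnected L R _ → Equivalence.to linkGraphConnected⇔shuntable linkConnected L R)
  (λ H → Equivalence.from linkGraphConnected⇔shuntable (shuntableAll connected ℓ H))
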